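{- Let $n\ge1$ and write $n=2^{\ell}d$ with $d$ odd. Then the number of $D$-nodes in the complete full binary tree with $n$ leaves is $\lfloor\log_2(d)\rfloor$.
   Context: A full binary tree is a rooted tree in which every node has $0$ or $2$ children. An internal node is a $D$-node if its two children have different numbers of descendant leaves. A complete full binary tree is a full binary tree in which every level except possibly the last is completely filled and all nodes of the last level are as far to the left as possible. -}

module Defs where

open import Data.Nat using (ℕ; zero; suc; _+_; _*_; _≤_)
open import Data.List using (List; []; _∷_; _++_)
open import Data.List.Membership.Propositional using (_∈_)
open import Data.Product using (_×_)
open import Function.Bundles using (_⇔_)
open import Relation.Binary.PropositionalEquality using (_≡_; _≢_)
open import Relation.Nullary using (¬_)
import Data.Nat
import Data.Nat.Divisibility
import Relation.Nullary

-- Full binary trees: every node has 0 or 2 children (built into the type).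
data Tree : Set where
  leaf : Tree
  node : Tree → Tree → Tree

leaves : Tree → ℕ
leaves leaf       = 1
leaves (node l r) = leaves l + leaves r

size : Tree → ℕ
size leaf       = 1
size (node l r) = suc (size l + size r)

dNodes : Tree → ℕ
dNodes leaf = 0
dNodes (node l r) with leaves l Data.Nat.≟ leaves r
... | Relation.Nullary.yes _ = dNodes l + dNodes r
... | Relation.Nullary.no  _ = suc (dNodes l + dNodes r)

-- Level-order (heap) position of each node: root has position i,
-- its left child 2i and its right child 2i+1.
positions : Tree → ℕ → List ℕ
positions leaf       i = i ∷ []
positions (node l r) i = i ∷ (positions l (2 * i) ++ positions r (suc (2 * i)))

-- A tree is complete (every level except possibly the last completely
-- filled, the last level filled from the left) iff its level-order positions
-- (root = 1) are exactly 1, 2, ..., (number of nodes).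
IsComplete : Tree → Set
IsComplete t = ∀ k → (k ∈ positions t 1) ⇔ (1 ≤ k × k ≤ size t)

Odd : ℕ → Set
Odd d = ¬ (Data.Nat.Divisibility._∣_ 2 d)

{-# OPTIONS --safe #-}
module Submission where

-- Number the nodes in level order. When the positions are exactly 1, …, N, every subtree is
-- again complete, and a complete tree whose levels 0, …, h are full (so 2 ^ h ≤ leaves ≤ 2 ^ (h + 1))
-- is a node with a perfect subtree of 2 ^ h′ leaves (h′ = h or h - 1) beside a complete
-- subtree with x leaves, where 2 ^ h′ ≤ 2x ≤ 2 ^ (h′ + 2). Perfect trees have no D-nodes and the
-- root is a D-node iff x ≠ 2 ^ h′; for such x, adding 2 ^ h′ raises the logarithm of the odd
-- part by exactly one, while for x = 2 ^ h′ both counts are powers of two. Induction on h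
-- then identifies the number of D-nodes with ⌊log₂⌋ of the odd part of the number of leaves.

open import Defs
open import Data.Nat
open import Data.Nat.Properties
open import Data.Nat.Divisibility using (_∣_; _∣?_; _∣0; ∣m+n∣m⇒∣n; ∣m⇒∣m*n; m∣m*n)
open import Data.Nat.Logarithm
open import Data.List.Membership.Propositional using (_∈_)
open import Data.List.Membership.Propositional.Properties using (∈-++⁺ˡ; ∈-++⁺ʳ; ∈-++⁻)
open import Data.List.Relation.Unary.Any using (here; there)
open import Data.Product using (∃-syntax; _×_; _,_; proj₂)
open import Data.Sum using (_⊎_; inj₁; inj₂)
open import Data.Empty using (⊥; ⊥-elim)
open import Function.Bundles using (Equivalence)
open import Relation.Binary.Definitions using (tri<; tri≈; tri>)
open import Relation.Binary.PropositionalEquality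
open import Relation.Nullary using (¬_; yes; no)
open import Relation.Nullary.Decidable using (from-no)
open import Algebra.Properties.CommutativeSemigroup *-commutativeSemigroup
  using (x∙yz≈y∙xz; x∙yz≈yx∙z)

⌊2*n/2⌋≡n : ∀ n → ⌊ 2 * n /2⌋ ≡ n
⌊2*n/2⌋≡n zero    = refl
⌊2*n/2⌋≡n (suc n) = trans (cong (λ m → ⌊ suc m /2⌋) (+-suc n (n + 0))) (cong suc (⌊2*n/2⌋≡n n))

⌊1+2*n/2⌋≡n : ∀ n → ⌊ suc (2 * n) /2⌋ ≡ n
⌊1+2*n/2⌋≡n zero    = refl
⌊1+2*n/2⌋≡n (suc n) = cong suc (trans (cong ⌊_/2⌋ (+-suc n (n + 0))) (⌊1+2*n/2⌋≡n n))

⌊n/2⌋<m : ∀ {n} m → n < 2 * m → ⌊ n /2⌋ < m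
⌊n/2⌋<m m n<2m = subst (_ ≤_) (⌊1+2*n/2⌋≡n m) (⌊n/2⌋-mono (s≤s n<2m))

2*n≡n+n : ∀ n → 2 * n ≡ n + n
2*n≡n+n n = cong (n +_) (+-identityʳ n)

n<2*n : ∀ {n} → 1 ≤ n → n < 2 * n
n<2*n {suc n} _ = s<s (m<m+n n z<s)

2^-bracket : ∀ x → 1 ≤ x → ∃[ m ] 2 ^ m ≤ x × x < 2 ^ suc m
2^-bracket (suc zero)    _ = 0 , ≤-refl , s≤s (s≤s z≤n)
2^-bracket (suc (suc x)) _ with 2^-bracket (suc x) (s≤s z≤n)
... | m , lo , hi with suc (suc x) <? 2 ^ suc m
...   | yes hi′ = m , m≤n⇒m≤1+n lo , hi′
...   | no ¬hi′ = suc m , ≮⇒≥ ¬hi′ , ≤-<-trans hi (^-monoʳ-< 2 (n<1+n 1) (n<1+n (suc m)))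

⌊log₂⌋-unique : ∀ m {x} → 2 ^ m ≤ x → x < 2 ^ suc m → ⌊log₂ x ⌋ ≡ m
⌊log₂⌋-unique zero    {suc zero}    _ _ = refl
⌊log₂⌋-unique zero    {suc (suc x)} _ (s≤s (s≤s ()))
⌊log₂⌋-unique (suc m) {x} lo hi =
  trans (sym (m∸n+n≡m 1≤log)) (trans (cong (_+ 1) log-1≡m) (+-comm m 1))
  where
  half-lo : 2 ^ m ≤ ⌊ x /2⌋
  half-lo = subst (_≤ ⌊ x /2⌋) (⌊2*n/2⌋≡n (2 ^ m)) (⌊n/2⌋-mono lo)
  log-1≡m : ⌊log₂ x ⌋ ∸ 1 ≡ m
  log-1≡m = trans (sym (⌊log₂⌊n/2⌋⌋≡⌊log₂n⌋∸1 x)) (⌊log₂⌋-unique m half-lo (⌊n/2⌋<m _ hi))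
  1≤log : 1 ≤ ⌊log₂ x ⌋
  1≤log = ≤-trans (s≤s z≤n) (subst (_≤ ⌊log₂ x ⌋) (⌊log₂[2^n]⌋≡n (suc m)) (⌊log₂⌋-mono-≤ lo))

⌊log₂⌋-+2^ : ∀ w {c} → 2 ^ w ≤ 2 * c → c < 2 ^ suc w → ⌊log₂ (c + 2 ^ w) ⌋ ≡ suc ⌊log₂ c ⌋
⌊log₂⌋-+2^ w {c} lo hi with 2^-bracket c (n≢0⇒n>0 λ { refl → <⇒≱ (m^n>0 2 w) lo })
... | m , c-lo , c-hi =
  trans (⌊log₂⌋-unique (suc m) lower upper) (cong suc (sym (⌊log₂⌋-unique m c-lo c-hi)))
  where
  m≤w : m ≤ w
  m≤w = ≮⇒≥ λ w<m → <⇒≱ hi (≤-trans (^-monoʳ-≤ 2 w<m) c-lo)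
  w≤1+m : w ≤ suc m
  w≤1+m = ≮⇒≥ λ 1+m<w → <⇒≱ (*-monoʳ-< 2 c-hi) (≤-trans (^-monoʳ-≤ 2 1+m<w) lo)
  lower : 2 ^ suc m ≤ c + 2 ^ w
  lower = subst (_≤ c + 2 ^ w) (sym (2*n≡n+n (2 ^ m))) (+-mono-≤ c-lo (^-monoʳ-≤ 2 m≤w))
  upper : c + 2 ^ w < 2 ^ suc (suc m)
  upper = subst (c + 2 ^ w <_) (sym (2*n≡n+n (2 ^ suc m))) (+-mono-<-≤ c-hi (^-monoʳ-≤ 2 w≤1+m))

odd-1 : Odd 1
odd-1 = from-no (2 ∣? 1)

odd-3 : Odd 3
odd-3 = from-no (2 ∣? 3)

odd⇒>0 : ∀ {c} → Odd c → 0 < c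
odd⇒>0 {zero}  odd-0 = ⊥-elim (odd-0 (2 ∣0))
odd⇒>0 {suc c} _     = z<s

odd+even : ∀ {c e} → Odd c → 2 ∣ e → Odd (c + e)
odd+even {c} {e} odd-c 2∣e 2∣c+e = odd-c (∣m+n∣m⇒∣n (subst (2 ∣_) (+-comm c e) 2∣c+e) 2∣e)

2∣2^suc : ∀ w → 2 ∣ 2 ^ suc w
2∣2^suc w = m∣m*n (2 ^ w)

odd-part-unique : ∀ a b {c d} → 2 ^ a * c ≡ 2 ^ b * d → Odd c → Odd d → c ≡ d
odd-part-unique zero    zero    {c} {d} eq _ _ = trans (sym (*-identityˡ c)) (trans eq (*-identityˡ d))
odd-part-unique zero    (suc b) {c} {d} eq odd-c _ =
  ⊥-elim (odd-c (subst (2 ∣_) (trans (sym eq) (*-identityˡ c)) (∣m⇒∣m*n d (2∣2^suc b))))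
odd-part-unique (suc a) zero    eq odd-c odd-d = sym (odd-part-unique zero (suc a) (sym eq) odd-d odd-c)
odd-part-unique (suc a) (suc b) {c} {d} eq odd-c odd-d =
  odd-part-unique a b (*-cancelˡ-≡ _ _ 2 (trans (sym (*-assoc 2 (2 ^ a) c)) (trans eq (*-assoc 2 (2 ^ b) d))))
    odd-c odd-d

odd-part-exponent< : ∀ {v c} h → Odd c → 2 ^ v * c < 2 ^ suc h → 2 ^ v * c ≢ 2 ^ h → v < h
odd-part-exponent< {v} {c} h odd-c x<2^[1+h] x≢2^h with <-cmp v h
... | tri< v<h _ _ = v<h
... | tri≈ _ refl _ = ⊥-elim (x≢2^h (trans (cong (2 ^ v *_) c≡1) (*-identityʳ (2 ^ v))))
  where
  c≡1 : c ≡ 1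
  c≡1 = ≤-antisym (≤-pred (*-cancelˡ-< (2 ^ v) c 2 (subst (2 ^ v * c <_) (*-comm 2 (2 ^ v)) x<2^[1+h])))
                  (odd⇒>0 odd-c)
... | tri> _ _ h<v =
  ⊥-elim (<⇒≱ x<2^[1+h] (≤-trans (^-monoʳ-≤ 2 h<v) (m≤m*n (2 ^ v) c {{>-nonZero (odd⇒>0 odd-c)}})))

LogOddPart : ℕ → ℕ → Set
LogOddPart n k = ∃[ v ] ∃[ c ] n ≡ 2 ^ v * c × Odd c × k ≡ ⌊log₂ c ⌋

LogOddPart-unique : ∀ {n k d} ℓ → LogOddPart n k → n ≡ 2 ^ ℓ * d → Odd d → k ≡ ⌊log₂ d ⌋
LogOddPart-unique ℓ (v , c , n≡ , odd-c , k≡) n≡′ odd-d =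
  trans k≡ (cong ⌊log₂_⌋ (odd-part-unique v ℓ (trans (sym n≡) n≡′) odd-c odd-d))

LogOddPart-2^ : ∀ h → LogOddPart (2 ^ h) 0
LogOddPart-2^ h = h , 1 , sym (*-identityʳ (2 ^ h)) , odd-1 , refl

LogOddPart-2^⇒0 : ∀ h {k} → LogOddPart (2 ^ h) k → k ≡ 0
LogOddPart-2^⇒0 h o = LogOddPart-unique h o (sym (*-identityʳ (2 ^ h))) odd-1

-- Writing x = 2 ^ v * c and 2 ^ h = 2 ^ v * 2 ^ (1 + w), the odd part of x + 2 ^ h is
-- c + 2 ^ (1 + w); the only exception is x = 2 ^ (1 + h), where the odd part becomes 3.
LogOddPart-+2^ : ∀ h {x k} → 2 ^ h ≤ 2 * x → x ≤ 2 ^ suc h → x ≢ 2 ^ h →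
                 LogOddPart x k → LogOddPart (x + 2 ^ h) (suc k)
LogOddPart-+2^ h {x} lo hi x≢2^h o with x ≟ 2 ^ suc h
... | yes refl = h , 3 , 2^[1+h]+2^h≡2^h*3 , odd-3 , cong suc (LogOddPart-2^⇒0 (suc h) o)
  where
  2^[1+h]+2^h≡2^h*3 : 2 ^ suc h + 2 ^ h ≡ 2 ^ h * 3
  2^[1+h]+2^h≡2^h*3 = trans (+-comm (2 ^ suc h) (2 ^ h))
                            (trans (cong (2 ^ h +_) (*-comm 2 (2 ^ h))) (sym (*-suc (2 ^ h) 2)))
... | no x≢2^[1+h] with o
...   | v , c , refl , odd-c , refl
  with w , 1+v+w≡h ← m≤n⇒∃[o]m+o≡n (odd-part-exponent< h odd-c (≤∧≢⇒< hi x≢2^[1+h]) x≢2^h) =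
  v , c + Q , x+2^h≡ , odd+even odd-c (2∣2^suc w) , sym (⌊log₂⌋-+2^ (suc w) Q≤2c c<2Q)
  where
  P = 2 ^ v
  Q = 2 ^ suc w
  instance
    P≢0 : NonZero P
    P≢0 = m^n≢0 2 v
  2^h≡PQ : 2 ^ h ≡ P * Q
  2^h≡PQ = trans (cong (2 ^_) (trans (sym 1+v+w≡h) (sym (+-suc v w)))) (^-distribˡ-+-* 2 v (suc w))
  Q≤2c : Q ≤ 2 * c
  Q≤2c = *-cancelˡ-≤ P (subst₂ _≤_ 2^h≡PQ (x∙yz≈y∙xz 2 P c) lo)
  c<2Q : c < 2 * Q
  c<2Q = *-cancelˡ-< P c (2 * Q)
           (subst (P * c <_) (trans (cong (2 *_) 2^h≡PQ) (x∙yz≈y∙xz 2 P Q)) (≤∧≢⇒< hi x≢2^[1+h]))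
  x+2^h≡ : P * c + 2 ^ h ≡ P * (c + Q)
  x+2^h≡ = trans (cong (P * c +_) 2^h≡PQ) (sym (*-distribˡ-+ P c Q))

dNodes-balanced : ∀ l r → leaves l ≡ leaves r → dNodes (node l r) ≡ dNodes l + dNodes r
dNodes-balanced l r eq with leaves l ≟ leaves r
... | yes _ = refl
... | no neq = ⊥-elim (neq eq)

dNodes-unbalanced : ∀ l r → leaves l ≢ leaves r → dNodes (node l r) ≡ suc (dNodes l + dNodes r)
dNodes-unbalanced l r neq with leaves l ≟ leaves r
... | yes eq = ⊥-elim (neq eq)
... | no _ = refl

dNodes-swap : ∀ l r → dNodes (node l r) ≡ dNodes (node r l)
dNodes-swap l r with leaves l ≟ leaves r | leaves r ≟ leaves l
... | yes _  | yes _   = +-comm (dNodes l) (dNodes r)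
... | no _   | no _    = cong suc (+-comm (dNodes l) (dNodes r))
... | yes eq | no neq  = ⊥-elim (neq (sym eq))
... | no neq | yes eq  = ⊥-elim (neq (sym eq))

data Perfect : ℕ → Tree → Set where
  leaf : Perfect 0 leaf
  node : ∀ {h l r} → Perfect h l → Perfect h r → Perfect (suc h) (node l r)

-- Complete h t: levels 0, …, h of t are full and level h + 1 is filled from the left.
data Complete : ℕ → Tree → Set where
  leaf          : Complete 0 leaf
  cherry        : Complete 0 (node leaf leaf)
  perfect-left  : ∀ {h l r} → Perfect (suc h) l → Complete h r → Complete (suc h) (node l r)
  perfect-right : ∀ {h l r} → Complete h l → Perfect h r → Complete (suc h) (node l r)

perfect-leaves : ∀ {h t} → Perfect h t → leaves t ≡ 2 ^ h
perfect-leaves leaf = refl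
perfect-leaves (node {h} pl pr) =
  trans (cong₂ _+_ (perfect-leaves pl) (perfect-leaves pr)) (sym (2*n≡n+n (2 ^ h)))

perfect-dNodes : ∀ {h t} → Perfect h t → dNodes t ≡ 0
perfect-dNodes leaf = refl
perfect-dNodes (node {l = l} {r} pl pr) =
  trans (dNodes-balanced l r (trans (perfect-leaves pl) (sym (perfect-leaves pr))))
        (cong₂ _+_ (perfect-dNodes pl) (perfect-dNodes pr))

complete-leaves : ∀ {h t} → Complete h t → 2 ^ h ≤ leaves t × leaves t ≤ 2 ^ suc h
complete-leaves leaf   = ≤-refl , s≤s z≤n
complete-leaves cherry = s≤s z≤n , ≤-refl
complete-leaves (perfect-left {h} {l} {r} pl cr) with complete-leaves cr
... | _ , hi rewrite perfect-leaves pl =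
  m≤m+n (2 ^ suc h) (leaves r) ,
  subst (2 ^ suc h + leaves r ≤_) (sym (2*n≡n+n (2 ^ suc h))) (+-monoʳ-≤ (2 ^ suc h) hi)
complete-leaves (perfect-right {h} {l} {r} cl pr) with complete-leaves cl
... | lo , hi rewrite perfect-leaves pr =
  subst (_≤ leaves l + 2 ^ h) (sym (2*n≡n+n (2 ^ h))) (+-monoˡ-≤ (2 ^ h) lo) ,
  subst (leaves l + 2 ^ h ≤_) (sym (2*n≡n+n (2 ^ suc h))) (+-mono-≤ hi (^-monoʳ-≤ 2 (n≤1+n h)))

LogOddPart-perfectʳ : ∀ {h} l {r} → Perfect h r → 2 ^ h ≤ 2 * leaves l → leaves l ≤ 2 ^ suc h →
                      LogOddPart (leaves l) (dNodes l) → LogOddPart (leaves (node l r)) (dNodes (node l r))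
LogOddPart-perfectʳ {h} l {r} pr lo hi ol with leaves l ≟ 2 ^ h
... | yes l≡2^h = subst₂ LogOddPart (sym leaves≡) (sym dNodes≡) (LogOddPart-2^ (suc h))
  where
  leaves≡ : leaves l + leaves r ≡ 2 ^ suc h
  leaves≡ = trans (cong₂ _+_ l≡2^h (perfect-leaves pr)) (sym (2*n≡n+n (2 ^ h)))
  dNodes≡ : dNodes (node l r) ≡ 0
  dNodes≡ = trans (dNodes-balanced l r (trans l≡2^h (sym (perfect-leaves pr))))
                  (cong₂ _+_ (LogOddPart-2^⇒0 h (subst (λ x → LogOddPart x (dNodes l)) l≡2^h ol))
                             (perfect-dNodes pr))
... | no l≢2^h = subst₂ LogOddPart (cong (leaves l +_) (sym (perfect-leaves pr))) (sym dNodes≡)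
                   (LogOddPart-+2^ h lo hi l≢2^h ol)
  where
  dNodes≡ : dNodes (node l r) ≡ suc (dNodes l)
  dNodes≡ = begin
    dNodes (node l r)           ≡⟨ dNodes-unbalanced l r (λ eq → l≢2^h (trans eq (perfect-leaves pr))) ⟩
    suc (dNodes l + dNodes r)   ≡⟨ cong (λ k → suc (dNodes l + k)) (perfect-dNodes pr) ⟩
    suc (dNodes l + 0)          ≡⟨ cong suc (+-identityʳ (dNodes l)) ⟩
    suc (dNodes l)              ∎
    where open ≡-Reasoning

LogOddPart-swap : ∀ l r → LogOddPart (leaves (node l r)) (dNodes (node l r)) →
                  LogOddPart (leaves (node r l)) (dNodes (node r l))
LogOddPart-swap l r = subst₂ LogOddPart (+-comm (leaves l) (leaves r)) (dNodes-swap l r)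

complete⇒LogOddPart : ∀ {h t} → Complete h t → LogOddPart (leaves t) (dNodes t)
complete⇒LogOddPart leaf   = LogOddPart-2^ 0
complete⇒LogOddPart cherry = LogOddPart-2^ 1
complete⇒LogOddPart (perfect-left {h} {l} {r} pl cr) with complete-leaves cr
... | lo , hi = LogOddPart-swap r l
                  (LogOddPart-perfectʳ r pl (*-monoʳ-≤ 2 lo) (≤-trans hi (^-monoʳ-≤ 2 (n≤1+n (suc h))))
                    (complete⇒LogOddPart cr))
complete⇒LogOddPart (perfect-right {h} {l} {r} cl pr) with complete-leaves cl
... | lo , hi = LogOddPart-perfectʳ l pr (≤-trans lo (m≤n*m (leaves l) 2)) hi (complete⇒LogOddPart cl)

-- i ≼ k: position k lies in the subtree rooted at position i of the heap numbering.
infix 4 _≼_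
data _≼_ (i : ℕ) : ℕ → Set where
  ≼-refl : i ≼ i
  ≼-step : ∀ {k} → i ≼ ⌊ k /2⌋ → i ≼ k

≼-trans : ∀ {i j k} → i ≼ j → j ≼ k → i ≼ k
≼-trans p ≼-refl     = p
≼-trans p (≼-step q) = ≼-step (≼-trans p q)

≼-left : ∀ i → i ≼ 2 * i
≼-left i = ≼-step (subst (i ≼_) (sym (⌊2*n/2⌋≡n i)) ≼-refl)

≼-right : ∀ i → i ≼ suc (2 * i)
≼-right i = ≼-step (subst (i ≼_) (sym (⌊1+2*n/2⌋≡n i)) ≼-refl)

≼⇒≤ : ∀ {i k} → i ≼ k → i ≤ k
≼⇒≤ ≼-refl             = ≤-refl
≼⇒≤ (≼-step {k = k} p) = ≤-trans (≼⇒≤ p) (⌊n/2⌋≤n k)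

≼-parent : ∀ {i k} → i ≼ k → i < k → i ≼ ⌊ k /2⌋
≼-parent ≼-refl     i<i = ⊥-elim (<-irrefl refl i<i)
≼-parent (≼-step p) _   = p

≼-comparable : ∀ {i j k} → i ≼ k → j ≼ k → i ≼ j ⊎ j ≼ i
≼-comparable ≼-refl     q          = inj₂ q
≼-comparable (≼-step p) ≼-refl     = inj₁ (≼-step p)
≼-comparable (≼-step p) (≼-step q) = ≼-comparable p q

siblings-disjoint : ∀ {i k} → 1 ≤ i → 2 * i ≼ k → suc (2 * i) ≼ k → ⊥
siblings-disjoint {i} 1≤i p q with ≼-comparable p q
... | inj₁ r = <⇒≱ (n<2*n 1≤i)
                   (≼⇒≤ (subst (2 * i ≼_) (⌊1+2*n/2⌋≡n i) (≼-parent r (n<1+n (2 * i)))))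
... | inj₂ r = 1+n≰n (≼⇒≤ r)

root∈positions : ∀ t i → i ∈ positions t i
root∈positions leaf       i = here refl
root∈positions (node l r) i = here refl

positions⊆≼ : ∀ t {i k} → k ∈ positions t i → i ≼ k
positions⊆≼ leaf       (here refl) = ≼-refl
positions⊆≼ (node l r) (here refl) = ≼-refl
positions⊆≼ (node l r) {i} (there p) with ∈-++⁻ (positions l (2 * i)) p
... | inj₁ q = ≼-trans (≼-left i) (positions⊆≼ l q)
... | inj₂ q = ≼-trans (≼-right i) (positions⊆≼ r q)

-- The subtrees of a complete tree with N nodes: placed at position i, the tree t
-- occupies exactly the descendants of i up to N.
record Spans (t : Tree) (i N : ℕ) : Set where
  field
    bounded : ∀ {k} → k ∈ positions t i → k ≤ N
    covers  : ∀ {k} → i ≼ k → k ≤ N → k ∈ positions t i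

open Spans

spans-leaf : ∀ {i N} → 1 ≤ i → Spans leaf i N → N < 2 * i
spans-leaf {i} 1≤i s = ≰⇒> λ 2i≤N → case-leaf (covers s (≼-left i) 2i≤N)
  where
  case-leaf : 2 * i ∈ positions leaf i → ⊥
  case-leaf (here 2i≡i) = <⇒≢ (n<2*n 1≤i) (sym 2i≡i)

spans-node : ∀ {l r i N} → Spans (node l r) i N → suc (2 * i) ≤ N
spans-node {l} {r} {i} s = bounded s (there (∈-++⁺ʳ (positions l (2 * i)) (root∈positions r _)))

spans-left : ∀ {l r i N} → 1 ≤ i → Spans (node l r) i N → Spans l (2 * i) N
bounded (spans-left _ s) p = bounded s (there (∈-++⁺ˡ p))
covers (spans-left {l} {r} {i} 1≤i s) p k≤N with covers s (≼-trans (≼-left i) p) k≤N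
... | here refl = ⊥-elim (<⇒≱ (n<2*n 1≤i) (≼⇒≤ p))
... | there q with ∈-++⁻ (positions l (2 * i)) q
...   | inj₁ q′ = q′
...   | inj₂ q′ = ⊥-elim (siblings-disjoint 1≤i p (positions⊆≼ r q′))

spans-right : ∀ {l r i N} → 1 ≤ i → Spans (node l r) i N → Spans r (suc (2 * i)) N
bounded (spans-right {l} {i = i} _ s) p = bounded s (there (∈-++⁺ʳ (positions l (2 * i)) p))
covers (spans-right {l} {r} {i} 1≤i s) p k≤N with covers s (≼-trans (≼-right i) p) k≤N
... | here refl = ⊥-elim (<⇒≱ (m<n⇒m<1+n (n<2*n 1≤i)) (≼⇒≤ p))
... | there q with ∈-++⁻ (positions l (2 * i)) q
...   | inj₁ q′ = ⊥-elim (siblings-disjoint 1≤i (positions⊆≼ l q′) p)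
...   | inj₂ q′ = q′

-- The descendants of i at depth h are the positions i * 2 ^ h, …, suc i * 2 ^ h ∸ 1.
LevelFull : ℕ → ℕ → ℕ → Set
LevelFull N i h = suc i * 2 ^ h ≤ suc N

LevelEmpty : ℕ → ℕ → ℕ → Set
LevelEmpty N i h = N < i * 2 ^ h

LevelFull-right : ∀ {N} i h → LevelFull N i (suc h) → LevelFull N (suc (2 * i)) h
LevelFull-right {N} i h = subst (_≤ suc N) (trans (x∙yz≈yx∙z (suc i) 2 (2 ^ h)) (cong (_* 2 ^ h) (*-suc 2 i)))

LevelFull-left : ∀ {N} i h → LevelFull N i (suc h) → LevelFull N (2 * i) h
LevelFull-left i h full = ≤-trans (*-monoˡ-≤ (2 ^ h) (n≤1+n (suc (2 * i)))) (LevelFull-right i h full)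

LevelFull⇒children : ∀ {N} i h → LevelFull N i (suc h) → suc (2 * i) ≤ N
LevelFull⇒children i h full = ≤-pred (≤-trans 2+2i≤ full)
  where
  2+2i≤ : suc (suc (2 * i)) ≤ suc i * 2 ^ suc h
  2+2i≤ = subst (_≤ suc i * 2 ^ suc h) (trans (*-comm (suc i) 2) (*-suc 2 i))
                (*-monoʳ-≤ (suc i) (*-monoʳ-≤ 2 (m^n>0 2 h)))

≤⇒LevelFull₀ : ∀ {N j} → j ≤ N → LevelFull N j 0
≤⇒LevelFull₀ {N} {j} j≤N = subst (_≤ suc N) (sym (*-identityʳ (suc j))) (s≤s j≤N)

LevelEmpty-left : ∀ {N} i h → LevelEmpty N i (suc h) → LevelEmpty N (2 * i) h
LevelEmpty-left {N} i h = subst (N <_) (x∙yz≈yx∙z i 2 (2 ^ h))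

LevelEmpty-right : ∀ {N} i h → LevelEmpty N i (suc h) → LevelEmpty N (suc (2 * i)) h
LevelEmpty-right i h empty = <-≤-trans (LevelEmpty-left i h empty) (*-monoˡ-≤ (2 ^ h) (n≤1+n (2 * i)))

¬LevelFull⇒LevelEmpty : ∀ {N} j h → ¬ LevelFull N j h → LevelEmpty N (suc j) h
¬LevelFull⇒LevelEmpty j h ¬full = <⇒≤ (≰⇒> ¬full)

LevelEmpty⇒childless : ∀ {N} i → LevelEmpty N i 1 → N < 2 * i
LevelEmpty⇒childless {N} i = subst (N <_) (*-comm i 2)

1≤2*i : ∀ {i} → 1 ≤ i → 1 ≤ 2 * i
1≤2*i 1≤i = ≤-trans 1≤i (<⇒≤ (n<2*n 1≤i))

spans⇒perfect : ∀ h {t i N} → 1 ≤ i → Spans t i N → LevelFull N i h → LevelEmpty N i (suc h) →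
                Perfect h t
spans⇒perfect zero    {leaf}         _   _ _    _     = leaf
spans⇒perfect zero    {node l r} {i} _   s _    empty =
  ⊥-elim (<⇒≱ (LevelEmpty⇒childless i empty) (<⇒≤ (spans-node s)))
spans⇒perfect (suc h) {leaf}     {i} 1≤i s full _     =
  ⊥-elim (<⇒≱ (spans-leaf 1≤i s) (<⇒≤ (LevelFull⇒children i h full)))
spans⇒perfect (suc h) {node l r} {i} 1≤i s full empty =
  node (spans⇒perfect h (1≤2*i 1≤i) (spans-left 1≤i s)
          (LevelFull-left i h full) (LevelEmpty-left i (suc h) empty))
       (spans⇒perfect h (s≤s z≤n) (spans-right 1≤i s)
          (LevelFull-right i h full) (LevelEmpty-right i (suc h) empty))

spans⇒complete : ∀ h {t i N} → 1 ≤ i → Spans t i N → LevelFull N i h → LevelEmpty N i (suc (suc h)) →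
                 Complete h t
spans⇒complete zero {leaf} _ _ _ _ = leaf
spans⇒complete zero {node l r} {i} 1≤i s _ empty
  with spans⇒perfect 0 (1≤2*i 1≤i) (spans-left 1≤i s)
         (≤⇒LevelFull₀ (<⇒≤ (spans-node s))) (LevelEmpty-left i 1 empty)
     | spans⇒perfect 0 (s≤s z≤n) (spans-right 1≤i s)
         (≤⇒LevelFull₀ (spans-node s)) (LevelEmpty-right i 1 empty)
... | leaf | leaf = cherry
spans⇒complete (suc h) {leaf} {i} 1≤i s full _ =
  ⊥-elim (<⇒≱ (spans-leaf 1≤i s) (<⇒≤ (LevelFull⇒children i h full)))
spans⇒complete (suc h) {node l r} {i} {N} 1≤i s full empty with suc (2 * i) * 2 ^ suc h ≤? suc N
... | yes left-full =
  perfect-left (spans⇒perfect (suc h) (1≤2*i 1≤i) (spans-left 1≤i s)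
                  left-full (LevelEmpty-left i (suc (suc h)) empty))
               (spans⇒complete h (s≤s z≤n) (spans-right 1≤i s)
                  (LevelFull-right i h full) (LevelEmpty-right i (suc (suc h)) empty))
... | no ¬left-full =
  perfect-right (spans⇒complete h (1≤2*i 1≤i) (spans-left 1≤i s)
                   (LevelFull-left i h full) (LevelEmpty-left i (suc (suc h)) empty))
                (spans⇒perfect h (s≤s z≤n) (spans-right 1≤i s)
                   (LevelFull-right i h full) (¬LevelFull⇒LevelEmpty (2 * i) (suc h) ¬left-full))

root-level : ∀ N → 1 ≤ N → ∃[ h ] LevelFull N 1 h × LevelEmpty N 1 (suc (suc h))
root-level N 1≤N with 2^-bracket (suc N) (s≤s z≤n)
... | zero  , _  , 1+N<2 = ⊥-elim (<⇒≱ 1+N<2 (s≤s 1≤N))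
... | suc h , lo , hi    = h , lo , subst (N <_) (sym (*-identityˡ _)) (<-trans (n<1+n N) hi)

isComplete⇒spans : ∀ {t} → IsComplete t → Spans t 1 (size t)
bounded (isComplete⇒spans complete-t) {k} p     = proj₂ (Equivalence.to (complete-t k) p)
covers  (isComplete⇒spans complete-t) {k} p k≤N = Equivalence.from (complete-t k) (≼⇒≤ p , k≤N)

isComplete⇒Complete : ∀ {t} → IsComplete t → ∃[ h ] Complete h t
isComplete⇒Complete {t} complete-t =
  let spans            = isComplete⇒spans complete-t
      h , full , empty = root-level (size t) (bounded spans (root∈positions t 1))
  in h , spans⇒complete h (s≤s z≤n) spans full empty

theorem44 : (n ℓ d : ℕ) → 1 ≤ n → n ≡ 2 ^ ℓ * d → Odd d →
    (t : Tree) → IsComplete t → leaves t ≡ n →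
    dNodes t ≡ ⌊log₂ d ⌋
-- The hypothesis 1 ≤ n is automatic, since every tree has a leaf.
theorem44 _ ℓ _ _ n≡2^ℓ*d odd-d _ complete-t leaves≡n =
  LogOddPart-unique ℓ (complete⇒LogOddPart (proj₂ (isComplete⇒Complete complete-t)))
                      (trans leaves≡n n≡2^ℓ*d) odd-d
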